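{- Suppose every cost change function $f_j$ ($1\le j\le n$) is monotonically increasing (non-decreasing). Then for every $i\in\{1,\dots,n\}$ the value function $V_i$ is monotonically increasing (non-decreasing) on its domain.
   Context: Data: an integer $n\ge 2$, reals $a_j\le 0\le b_j$ and piecewise linear lower semicontinuous functions $f_j:[a_j,b_j]\to\mathbb{R}$ for $1\le j\le n$ (piecewise linear: affine on each of finitely many consecutive open intervals partitioning the domain), real costs $c_{ji}$ for $1\le j<i\le n$, and a capacity $Q_{max}\ge 0$. The value functions are defined recursively by $V_1(q)=f_1(q)$ for $q\in[0,\min(b_1,Q_{max})]$, and for $i\ge 2$, $V_i(q)=\min_{j<i}\ \min\{V_j(q-y)+c_{j,i}+f_i(y): y\in[a_i,b_i],\ q-y\in\mathcal{D}(V_j)\}$, defined for those $q\in[0,Q_{max}]$ for which the feasible set is nonempty ($\mathcal{D}(V_j)$ denotes the domain of $V_j$). $V_i(q)$ is the optimal cost of a partial route starting at location $1$ and ending at location $i$ with vehicle load $q$ on leaving $i$. -}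

module Defs where

open import Level using (0ℓ)
open import Data.Nat as ℕ using (ℕ; suc)
open import Data.Fin using (Fin; toℕ)
open import Data.Product using (Σ; ∃; _×_; _,_)
open import Relation.Binary.PropositionalEquality using (_≡_; _≢_)
open import Relation.Nullary using (¬_)
open import Function.Bundles using (_⇔_)
open import Data.Sum using (_⊎_; [_,_]′)
open import Data.Fin using (inject₁) renaming (suc to fsuc)

-- Ordered fields.  The real numbers are not available in agda-stdlib,
-- so the statement is made for an arbitrary ordered field (which
-- includes ℝ).  Equality is propositional equality.

record OrderedField : Set₁ where
  infixl 6 _+_ _-_
  infixl 7 _*_
  infix  4 _≤_ _<_
  field
    Carrier : Set
    0# 1#   : Carrier
    _+_ _*_ : Carrier → Carrier → Carrier
    -_      : Carrier → Carrier
    _⁻¹     : Carrier → Carrier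
    _≤_     : Carrier → Carrier → Set
    +-assoc    : ∀ x y z → (x + y) + z ≡ x + (y + z)
    +-comm     : ∀ x y → x + y ≡ y + x
    +-identityˡ : ∀ x → 0# + x ≡ x
    -‿inverseˡ : ∀ x → (- x) + x ≡ 0#
    *-assoc    : ∀ x y z → (x * y) * z ≡ x * (y * z)
    *-comm     : ∀ x y → x * y ≡ y * x
    *-identityˡ : ∀ x → 1# * x ≡ x
    distribˡ   : ∀ x y z → x * (y + z) ≡ (x * y) + (x * z)
    0≢1        : 0# ≢ 1#
    ⁻¹-inverseˡ : ∀ x → x ≢ 0# → (x ⁻¹) * x ≡ 1#
    ≤-refl     : ∀ x → x ≤ x
    ≤-antisym  : ∀ {x y} → x ≤ y → y ≤ x → x ≡ y
    ≤-trans    : ∀ {x y z} → x ≤ y → y ≤ z → x ≤ z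
    ≤-total    : ∀ x y → (x ≤ y) ⊎ (y ≤ x)
    +-monoˡ-≤  : ∀ {x y} z → x ≤ y → x + z ≤ y + z
    *-nonneg   : ∀ {x y} → 0# ≤ x → 0# ≤ y → 0# ≤ x * y

  _-_ : Carrier → Carrier → Carrier
  x - y = x + (- y)

  _<_ : Carrier → Carrier → Set
  x < y = x ≤ y × ¬ (x ≡ y)

  ∣_∣ : Carrier → Carrier
  ∣ x ∣ = [ (λ _ → x) , (λ _ → - x) ]′ (≤-total 0# x)

module WithField (F : OrderedField) where
  open OrderedField F

  InInterval : Carrier → Carrier → Carrier → Set
  InInterval lo hi x = lo ≤ x × x ≤ hi

  MonotoneOn : Carrier → Carrier → (Carrier → Carrier) → Set
  MonotoneOn lo hi g = ∀ x y → InInterval lo hi x → InInterval lo hi y →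
                       x ≤ y → g x ≤ g y

  LowerSemicontinuousOn : Carrier → Carrier → (Carrier → Carrier) → Set
  LowerSemicontinuousOn lo hi g =
    ∀ x → InInterval lo hi x → ∀ ε → 0# < ε →
    ∃ λ δ → 0# < δ × (∀ y → InInterval lo hi y → ∣ y - x ∣ < δ → g x - ε < g y)

  PiecewiseLinearOn : Carrier → Carrier → (Carrier → Carrier) → Set
  PiecewiseLinearOn lo hi g =
    Σ ℕ λ m → Σ (Fin (suc m) → Carrier) λ t →
      t Data.Fin.zero ≡ lo × t (Data.Fin.fromℕ m) ≡ hi ×
      (∀ (l : Fin m) → t (inject₁ l) < t (fsuc l)) ×
      (∀ (l : Fin m) → ∃ λ α → ∃ λ β → ∀ x →
         t (inject₁ l) < x → x < t (fsuc l) → g x ≡ (α * x) + β)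

  -- Locations 1,…,n are Fin n (location 1 is the
  -- index with toℕ i ≡ 0).  D i is the domain of V_i and V i its values
  -- on that domain.  IsValueFamily states exactly the recursive
  -- definition of the paper: V_1 = f_1 on [0 , min(b_1 , Qmax)], and for
  -- i ≥ 2, q ∈ D(V_i) iff q ∈ [0 , Qmax] and the feasible set is nonempty,
  -- in which case V_i(q) is the minimum over it.
  module _ (n : ℕ) (a b : Fin n → Carrier) (f : Fin n → Carrier → Carrier)
           (c : Fin n → Fin n → Carrier) (Qmax : Carrier)
           (D : Fin n → Carrier → Set) (V : Fin n → Carrier → Carrier) where

    Feasible : Fin n → Carrier → Fin n → Carrier → Set
    Feasible i q j y = toℕ j ℕ.< toℕ i × InInterval (a i) (b i) y × D j (q - y)

    Cost : Fin n → Carrier → Fin n → Carrier → Carrier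
    Cost i q j y = (V j (q - y) + c j i) + f i y

    record IsValueFamily : Set where
      field
        first-domain : ∀ i q → toℕ i ≡ 0 →
          D i q ⇔ (0# ≤ q × q ≤ b i × q ≤ Qmax)
        first-value  : ∀ i q → toℕ i ≡ 0 → D i q → V i q ≡ f i q
        rest-domain  : ∀ i q → ¬ (toℕ i ≡ 0) →
          D i q ⇔ (InInterval 0# Qmax q × ∃ λ j → ∃ λ y → Feasible i q j y)
        rest-lower   : ∀ i q → ¬ (toℕ i ≡ 0) → D i q →
          ∀ j y → Feasible i q j y → V i q ≤ Cost i q j y
        rest-attained : ∀ i q → ¬ (toℕ i ≡ 0) → D i q →
          ∃ λ j → ∃ λ y → Feasible i q j y × V i q ≡ Cost i q j y

-- By well-founded induction on the location i, the domain of V_i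
-- is downward closed in [0, ∞) and V_i is monotone on it.  For i ≥ 2 and
-- q ≤ q′, let (j , y) realise V_i(q′) and put y* = max(a_i , q − (q′ − y)).
-- Then (j , y*) is feasible for q (using downward closedness of D(V_j) when
-- y* = a_i), y* ≤ y and q − y* ≤ q′ − y, so by monotonicity of f_i and,
-- inductively, of V_j the cost of (j , y*) at q is at most V_i(q′).
module Submission where

open import Defs
open import Level using (0ℓ)
open import Data.Nat as ℕ using (ℕ)
open import Data.Fin using (Fin; toℕ) renaming (_<_ to _<ᶠ_)
open import Data.Fin.Induction using (<-wellFounded)
open import Data.Product using (∃; _×_; _,_; proj₁; proj₂)
open import Data.Sum using (inj₁; inj₂)
open import Function using (_∘_)
open import Function.Bundles using (Equivalence)
open import Induction.WellFounded using (module All)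
open import Relation.Binary.PropositionalEquality
open import Relation.Nullary using (yes; no; ¬_)

module OrderedFieldProperties (F : OrderedField) where
  open OrderedField F
  open ≡-Reasoning

  +-identityʳ : ∀ x → x + 0# ≡ x
  +-identityʳ x = trans (+-comm x 0#) (+-identityˡ x)

  -‿inverseʳ : ∀ x → x + - x ≡ 0#
  -‿inverseʳ x = trans (+-comm x (- x)) (-‿inverseˡ x)

  [x-y]+y≡x : ∀ x y → (x - y) + y ≡ x
  [x-y]+y≡x x y = begin
    (x + - y) + y ≡⟨ +-assoc x (- y) y ⟩
    x + (- y + y) ≡⟨ cong (x +_) (-‿inverseˡ y) ⟩
    x + 0#        ≡⟨ +-identityʳ x ⟩
    x             ∎

  [x+y]-x≡y : ∀ x y → (x + y) - x ≡ y
  [x+y]-x≡y x y = begin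
    (x + y) + - x ≡⟨ cong (_+ - x) (+-comm x y) ⟩
    (y + x) + - x ≡⟨ +-assoc y x (- x) ⟩
    y + (x + - x) ≡⟨ cong (y +_) (-‿inverseʳ x) ⟩
    y + 0#        ≡⟨ +-identityʳ y ⟩
    y             ∎

  x-[x-y]≡y : ∀ x y → x - (x - y) ≡ y
  x-[x-y]≡y x y = begin
    x - (x - y)             ≡⟨ cong (_- (x - y)) (sym ([x-y]+y≡x x y)) ⟩
    ((x - y) + y) - (x - y) ≡⟨ [x+y]-x≡y (x - y) y ⟩
    y                       ∎

  x+[y-x]≡y : ∀ x y → x + (y - x) ≡ y
  x+[y-x]≡y x y = trans (+-comm x (y - x)) ([x-y]+y≡x y x)

  [x-y]+[y-z]≡x-z : ∀ x y z → (x - y) + (y - z) ≡ x - z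
  [x-y]+[y-z]≡x-z x y z = begin
    (x - y) + (y + - z) ≡⟨ sym (+-assoc (x - y) y (- z)) ⟩
    ((x - y) + y) + - z ≡⟨ cong (_+ - z) ([x-y]+y≡x x y) ⟩
    x + - z             ∎

  ≤-reflexive : ∀ {x y} → x ≡ y → x ≤ y
  ≤-reflexive {x} refl = ≤-refl x

  +-monoʳ-≤ : ∀ {x y} z → x ≤ y → z + x ≤ z + y
  +-monoʳ-≤ {x} {y} z x≤y = subst₂ _≤_ (+-comm x z) (+-comm y z) (+-monoˡ-≤ z x≤y)

  +-mono-≤ : ∀ {x x′ y y′} → x ≤ x′ → y ≤ y′ → x + y ≤ x′ + y′
  +-mono-≤ {x′ = x′} {y} x≤x′ y≤y′ = ≤-trans (+-monoˡ-≤ y x≤x′) (+-monoʳ-≤ x′ y≤y′)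

  x-y≤z⇒x-z≤y : ∀ {x y z} → x - y ≤ z → x - z ≤ y
  x-y≤z⇒x-z≤y {x} {y} {z} x-y≤z =
    subst₂ _≤_ ([x-y]+[y-z]≡x-z x y z) (x+[y-x]≡y z y) (+-monoˡ-≤ (y - z) x-y≤z)

  x≤0⇒y≤y-x : ∀ {x} y → x ≤ 0# → y ≤ y - x
  x≤0⇒y≤y-x {x} y x≤0 =
    subst₂ _≤_ (x+[y-x]≡y x y) (+-identityˡ (y - x)) (+-monoˡ-≤ (y - x) x≤0)

module ValueFamilyProperties
  (F : OrderedField) (n : ℕ) (a b : Fin n → OrderedField.Carrier F)
  (f : Fin n → OrderedField.Carrier F → OrderedField.Carrier F)
  (c : Fin n → Fin n → OrderedField.Carrier F) (Qmax : OrderedField.Carrier F)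
  (D : Fin n → OrderedField.Carrier F → Set)
  (V : Fin n → OrderedField.Carrier F → OrderedField.Carrier F) where

  open OrderedField F
  open OrderedFieldProperties F
  open WithField F

  DownwardClosed : Fin n → Set
  DownwardClosed j = ∀ {x z} → 0# ≤ x → x ≤ z → D j z → D j x

  MonotoneOnDomain : Fin n → Set
  MonotoneOnDomain j = ∀ q q′ → D j q → D j q′ → q ≤ q′ → V j q ≤ V j q′

  feasible-shift : ∀ {i j q q′ y} → a i ≤ 0# → DownwardClosed j →
                   0# ≤ q → q ≤ q′ → Feasible n a b f c Qmax D V i q′ j y →
                   ∃ λ y* → Feasible n a b f c Qmax D V i q j y* × y* ≤ y × q - y* ≤ q′ - y
  feasible-shift {i} {j} {q} {q′} {y} aᵢ≤0 downⱼ 0≤q q≤q′ (j<i , (aᵢ≤y , y≤bᵢ) , Dⱼ)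
    with ≤-total (a i) (q - (q′ - y))
  ... | inj₁ aᵢ≤y* =
    q - (q′ - y) ,
    (j<i , (aᵢ≤y* , ≤-trans y*≤y y≤bᵢ) , subst (D j) (sym (x-[x-y]≡y q (q′ - y))) Dⱼ) ,
    y*≤y , ≤-reflexive (x-[x-y]≡y q (q′ - y))
    where
    y*≤y : q - (q′ - y) ≤ y
    y*≤y = subst (q - (q′ - y) ≤_) (x-[x-y]≡y q′ y) (+-monoˡ-≤ (- (q′ - y)) q≤q′)
  ... | inj₂ y*≤aᵢ =
    a i ,
    (j<i , (≤-refl (a i) , ≤-trans aᵢ≤y y≤bᵢ) , downⱼ 0≤q-aᵢ q-aᵢ≤q′-y Dⱼ) ,
    aᵢ≤y , q-aᵢ≤q′-y
    where
    q-aᵢ≤q′-y : q - a i ≤ q′ - y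
    q-aᵢ≤q′-y = x-y≤z⇒x-z≤y y*≤aᵢ
    0≤q-aᵢ : 0# ≤ q - a i
    0≤q-aᵢ = ≤-trans 0≤q (x≤0⇒y≤y-x q aᵢ≤0)

  module _ (VF : IsValueFamily n a b f c Qmax D V) (a≤0 : ∀ j → a j ≤ 0#)
           (f-mono : ∀ j → MonotoneOn (a j) (b j) (f j)) where
    open IsValueFamily VF
    open Equivalence

    first-downwardClosed : ∀ {i} → toℕ i ≡ 0 → DownwardClosed i
    first-downwardClosed {i} i≡0 {x} {z} 0≤x x≤z Dz with to (first-domain i z i≡0) Dz
    ... | _ , z≤b , z≤Q = from (first-domain i x i≡0) (0≤x , ≤-trans x≤z z≤b , ≤-trans x≤z z≤Q)

    first-monotone : ∀ {i} → toℕ i ≡ 0 → MonotoneOnDomain i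
    first-monotone {i} i≡0 q q′ Dq Dq′ q≤q′
      with to (first-domain i q i≡0) Dq | to (first-domain i q′ i≡0) Dq′
    ... | 0≤q , q≤b , _ | 0≤q′ , q′≤b , _ =
      subst₂ _≤_ (sym (first-value i q i≡0 Dq)) (sym (first-value i q′ i≡0 Dq′))
        (f-mono i q q′ (≤-trans (a≤0 i) 0≤q , q≤b) (≤-trans (a≤0 i) 0≤q′ , q′≤b) q≤q′)

    rest-downwardClosed : ∀ {i} → ¬ toℕ i ≡ 0 → (∀ {j} → j <ᶠ i → DownwardClosed j) →
                          DownwardClosed i
    rest-downwardClosed {i} i≢0 ih {x} {z} 0≤x x≤z Dz with to (rest-domain i z i≢0) Dz
    ... | (_ , z≤Q) , j , y , feas@(j<i , _)
      with feasible-shift (a≤0 i) (ih j<i) 0≤x x≤z feas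
    ... | y* , feas* , _ = from (rest-domain i x i≢0) ((0≤x , ≤-trans x≤z z≤Q) , j , y* , feas*)

    rest-monotone : ∀ {i} → ¬ toℕ i ≡ 0 →
                    (∀ {j} → j <ᶠ i → DownwardClosed j × MonotoneOnDomain j) →
                    MonotoneOnDomain i
    rest-monotone {i} i≢0 ih q q′ Dq Dq′ q≤q′ with rest-attained i q′ i≢0 Dq′
    ... | j , y , feas@(j<i , y∈ , Dⱼ) , Vᵢq′≡cost
      with feasible-shift (a≤0 i) (proj₁ (ih j<i)) 0≤q q≤q′ feas
      where
      0≤q : 0# ≤ q
      0≤q = proj₁ (proj₁ (to (rest-domain i q i≢0) Dq))
    ... | y* , feas*@(_ , y*∈ , Dⱼ*) , y*≤y , q-y*≤q′-y =
      ≤-trans (rest-lower i q i≢0 Dq j y* feas*)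
        (subst (Cost n a b f c Qmax D V i q j y* ≤_) (sym Vᵢq′≡cost)
          (+-mono-≤ (+-monoˡ-≤ (c j i) (proj₂ (ih j<i) _ _ Dⱼ* Dⱼ q-y*≤q′-y))
                    (f-mono i y* y y*∈ y∈ y*≤y)))

    downwardClosed×monotone : ∀ i → DownwardClosed i × MonotoneOnDomain i
    downwardClosed×monotone = All.wfRec <-wellFounded 0ℓ _ step
      where
      step : ∀ i → (∀ {j} → j <ᶠ i → DownwardClosed j × MonotoneOnDomain j) →
             DownwardClosed i × MonotoneOnDomain i
      step i ih with toℕ i ℕ.≟ 0
      ... | yes i≡0 = first-downwardClosed i≡0 , first-monotone i≡0
      ... | no i≢0  = rest-downwardClosed i≢0 (proj₁ ∘ ih) , rest-monotone i≢0 ih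

lemma7 : (F : OrderedField) → let open OrderedField F in let open WithField F in
    (n : ℕ) → 2 ℕ.≤ n →
    (a b : Fin n → Carrier) (f : Fin n → Carrier → Carrier)
    (c : Fin n → Fin n → Carrier) (Qmax : Carrier) →
    (∀ j → a j ≤ 0# × 0# ≤ b j) →
    (∀ j → PiecewiseLinearOn (a j) (b j) (f j)) →
    (∀ j → LowerSemicontinuousOn (a j) (b j) (f j)) →
    0# ≤ Qmax →
    (∀ j → MonotoneOn (a j) (b j) (f j)) →
    (D : Fin n → Carrier → Set) (V : Fin n → Carrier → Carrier) →
    IsValueFamily n a b f c Qmax D V →
    ∀ i q q′ → D i q → D i q′ → q ≤ q′ → V i q ≤ V i q′
lemma7 F n _ a b f c Qmax a≤0≤b _ _ _ f-mono D V VF i =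
  proj₂ (downwardClosed×monotone VF (proj₁ ∘ a≤0≤b) f-mono i)
  where open ValueFamilyProperties F n a b f c Qmax D V
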